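{- Let $G$ be a simple graph on $n$ vertices and $r>0$ an integer. The following are equivalent: (1) $Z^{(r)}(G)=n$; (2) $Z_+^{(r)}(G)=n$; (3) the edge configurations of $\Gamma(G,r)$ include the graph with no edges; (4) every unique shortest path in $G$ contains at most $r$ vertices.
   Context: A path in $G$ from $i$ to $j$ is a unique shortest path if it is the only shortest path between $i$ and $j$. Zero forcing on a simple graph $H$: an initial set is blue; repeatedly, a blue vertex with exactly one white neighbor forces that neighbor blue; $Z(H)$ is the minimum size of an initial set making all vertices blue. PSD zero forcing: given the current blue set $B$, let $W_1,\ldots,W_k$ be the vertex sets of the components of $H-B$; a blue vertex $u$ may force a white $w\in W_i$ if $w$ is the only white neighbor of $u$ in $H[B\cup W_i]$; $Z_+(H)$ is the minimum size of an initial set making all vertices blue. A lazy walk of length $r$ is a sequence $u_0,\ldots,u_r$ with $u_{t+1}=u_t$ or $u_tu_{t+1}\in E(G)$. $\Gamma(G,r)$ is the multigraph on $V(G)$ with the number of edges between distinct $i,j$ equal to the number of lazy walks from $i$ to $j$ of length at most $r$. An edge configuration of a multigraph $\Gamma$ is a simple graph $H$ on its vertex set such that a pair joined by exactly one edge in $\Gamma$ is an edge of $H$, a pair joined by no edge is not, and a pair joined by two or more edges may or may not be. $Z^{(r)}(G)=\max Z(H)$ and $Z_+^{(r)}(G)=\max Z_+(H)$, maxima over all edge configurations $H$ of $\Gamma(G,r)$. -}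

module Defs where

open import Data.Bool using (Bool; true; false; T; if_then_else_)
open import Data.Nat using (ℕ; zero; suc; _+_; _*_; _≤_; _<_)
open import Data.Nat.ListAction using (sum)
open import Data.Fin using (Fin; _≟_)
open import Data.Fin.Subset using (Subset; _∈_; _∉_; ⁅_⁆; _∪_; ⊤; ∣_∣)
open import Data.List using (List; []; _∷_; length; map; allFin; upTo)
open import Data.List.Relation.Unary.Unique.Propositional using (Unique)
open import Data.Product using (Σ; _×_; _,_; ∃)
open import Relation.Nullary using (¬_; yes; no)
open import Relation.Binary.PropositionalEquality using (_≡_; _≢_)

record SimpleGraph (n : ℕ) : Set where
  field
    adj   : Fin n → Fin n → Bool
    sym   : ∀ i j → adj i j ≡ adj j i
    irrfl : ∀ i → adj i i ≡ false
open SimpleGraph public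

Adj : ∀ {n} → SimpleGraph n → Fin n → Fin n → Set
Adj G i j = T (adj G i j)

emptyGraph : ∀ n → SimpleGraph n
emptyGraph n = record { adj = λ _ _ → false ; sym = λ _ _ → _≡_.refl ; irrfl = λ _ → _≡_.refl }

lazyStep : ∀ {n} → SimpleGraph n → Fin n → Fin n → ℕ
lazyStep G k j with k ≟ j
... | yes _ = 1
... | no  _ = if adj G k j then 1 else 0

lazyWalks : ∀ {n} → SimpleGraph n → ℕ → Fin n → Fin n → ℕ
lazyWalks G zero i j with i ≟ j
... | yes _ = 1
... | no  _ = 0
lazyWalks {n} G (suc t) i j =
  sum (map (λ k → lazyWalks G t i k * lazyStep G k j) (allFin n))

-- number of edges of Γ(G,r) between i and j (i ≠ j):
-- lazy walks from i to j of length at most r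
gammaMult : ∀ {n} → SimpleGraph n → ℕ → Fin n → Fin n → ℕ
gammaMult G r i j = sum (map (λ t → lazyWalks G t i j) (upTo (suc r)))

IsEdgeConfig : ∀ {n} → SimpleGraph n → ℕ → SimpleGraph n → Set
IsEdgeConfig G r H =
  ∀ i j → i ≢ j →
    (gammaMult G r i j ≡ 1 → Adj H i j) ×
    (gammaMult G r i j ≡ 0 → ¬ Adj H i j)

ZFForce : ∀ {n} → SimpleGraph n → Subset n → Fin n → Fin n → Set
ZFForce H B u w =
  u ∈ B × w ∉ B × Adj H u w × (∀ x → Adj H u x → x ∉ B → x ≡ w)

data ZFReach {n} (H : SimpleGraph n) (S : Subset n) : Subset n → Set where
  start : ZFReach H S S
  force : ∀ {B} u w → ZFReach H S B → ZFForce H B u w → ZFReach H S (B ∪ ⁅ w ⁆)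

IsZFSet : ∀ {n} → SimpleGraph n → Subset n → Set
IsZFSet H S = ZFReach H S ⊤

IsZ : ∀ {n} → SimpleGraph n → ℕ → Set
IsZ H k = (Σ _ λ S → IsZFSet H S × ∣ S ∣ ≡ k) × (∀ S → IsZFSet H S → k ≤ ∣ S ∣)

data WhiteConn {n} (H : SimpleGraph n) (B : Subset n) (x : Fin n) : Fin n → Set where
  here : x ∉ B → WhiteConn H B x x
  step : ∀ {y z} → WhiteConn H B x y → Adj H y z → z ∉ B → WhiteConn H B x z

-- u (blue) forces w (white): w is the only white neighbour of u in
-- H[B ∪ W], W the component of H - B containing w
PSDForce : ∀ {n} → SimpleGraph n → Subset n → Fin n → Fin n → Set
PSDForce H B u w =
  u ∈ B × w ∉ B × Adj H u w ×
  (∀ x → Adj H u x → x ∉ B → WhiteConn H B w x → x ≡ w)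

data PSDReach {n} (H : SimpleGraph n) (S : Subset n) : Subset n → Set where
  start : PSDReach H S S
  force : ∀ {B} u w → PSDReach H S B → PSDForce H B u w → PSDReach H S (B ∪ ⁅ w ⁆)

IsPSDSet : ∀ {n} → SimpleGraph n → Subset n → Set
IsPSDSet H S = PSDReach H S ⊤

IsZ₊ : ∀ {n} → SimpleGraph n → ℕ → Set
IsZ₊ H k = (Σ _ λ S → IsPSDSet H S × ∣ S ∣ ≡ k) × (∀ S → IsPSDSet H S → k ≤ ∣ S ∣)

IsZr : ∀ {n} → SimpleGraph n → ℕ → ℕ → Set
IsZr G r k =
  (Σ _ λ H → IsEdgeConfig G r H × IsZ H k) ×
  (∀ H m → IsEdgeConfig G r H → IsZ H m → m ≤ k)

IsZ₊r : ∀ {n} → SimpleGraph n → ℕ → ℕ → Set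
IsZ₊r G r k =
  (Σ _ λ H → IsEdgeConfig G r H × IsZ₊ H k) ×
  (∀ H m → IsEdgeConfig G r H → IsZ₊ H m → m ≤ k)

data Walk {n} (G : SimpleGraph n) : Fin n → Fin n → List (Fin n) → Set where
  single : ∀ i → Walk G i i (i ∷ [])
  cons   : ∀ {i k j p} → Adj G i k → Walk G k j p → Walk G i j (i ∷ p)

IsPath : ∀ {n} → SimpleGraph n → Fin n → Fin n → List (Fin n) → Set
IsPath G i j p = Walk G i j p × Unique p

IsShortestPath : ∀ {n} → SimpleGraph n → Fin n → Fin n → List (Fin n) → Set
IsShortestPath G i j p =
  IsPath G i j p × (∀ q → IsPath G i j q → length p ≤ length q)

IsUniqueShortestPath : ∀ {n} → SimpleGraph n → Fin n → Fin n → List (Fin n) → Set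
IsUniqueShortestPath G i j p =
  IsShortestPath G i j p × (∀ q → IsShortestPath G i j q → q ≡ p)

-- An edge uv of H lets the set of all vertices but v force v, so Z(H) = n or
-- Z₊(H) = n forces H to be edgeless, while the edgeless graph has Z = Z₊ = n.
-- Hence (1), (2) and (3) all say that the empty graph is an edge configuration,
-- i.e. that no pair i ≠ j is joined by exactly one edge of Γ(G,r).
-- Lazy walks from i to j of length t exist exactly for t ≥ d(i,j), and those of
-- length d(i,j) are the shortest paths; so the multiplicity of ij is 1 iff
-- d(i,j) = r and the shortest path is unique.  A unique shortest path with more
-- than r vertices has a prefix with r + 1 vertices, again a unique shortest path.
module Submission where

open import Defs hiding (sym)
open import Data.Bool using (true; false; T)
open import Data.Fin using (Fin; _≟_)
open import Data.Fin.Subset using (⁅_⁆; ⊤; ∣_∣; ∁) renaming (_∈_ to _∈ˢ_)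
open import Data.Fin.Subset.Properties
  using (∣⊤∣≡n; ∣∁p∣≡n∸∣p∣; ∣⁅x⁆∣≡1; ∪-inverseˡ; x∉p⇒x∈∁p; x≢y⇒x∉⁅y⁆; x∈p⇒x∉∁p; x∈⁅x⁆; x∉∁p⇒x∈p; x∈⁅y⁆⇒x≡y)
open import Data.List using (List; []; _∷_; length; map; allFin; upTo; _++_; _∷ʳ_)
open import Data.List.Properties using (length-++; upTo-∷ʳ; map-++; ∷ʳ-injective; ≡-dec)
open import Data.List.Membership.Propositional using (_∈_; _∉_)
open import Data.List.Membership.Propositional.Properties using (∈-allFin; ∈-++⁻; ∈-upTo⁺; ∈-upTo⁻)
import Data.List.Relation.Unary.All as All
open All using ([]; _∷_)
open import Data.List.Relation.Unary.All.Properties using (++⁻ˡ)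
open import Data.List.Relation.Unary.Any using (here; there; any?)
open import Data.List.Relation.Unary.AllPairs using ([]; _∷_)
open import Data.List.Relation.Unary.Unique.Propositional using (Unique)
open import Data.List.Relation.Unary.Unique.Propositional.Properties using (allFin⁺; ++⁺)
open import Data.Nat using (ℕ; zero; suc; _+_; _*_; _∸_; _≤_; _<_; _≤′_; z≤n; s≤s; z<s; ≤′-reflexive; ≤′-step)
open import Data.Nat.ListAction using (sum)
open import Data.Nat.ListAction.Properties using (sum-++)
open import Data.Nat.Properties hiding (_≟_)
open import Data.Product using (∃-syntax; ∃₂; _×_; _,_; proj₁; proj₂)
open import Data.Sum using (_⊎_; inj₁; inj₂)
open import Function using (_∘_)
open import Function.Bundles using (_⇔_; mk⇔; Equivalence)
open import Function.Properties.Equivalence using () renaming (sym to ⇔-sym; trans to ⇔-trans)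
open import Relation.Binary.PropositionalEquality using (_≡_; _≢_; refl; sym; trans; cong; cong₂; subst; subst₂; module ≡-Reasoning)
open import Relation.Nullary using (¬_; yes; no; contradiction)

open Equivalence

module _ {A : Set} (f : A → ℕ) where

  ∈⇒≤sum : ∀ {x xs} → x ∈ xs → f x ≤ sum (map f xs)
  ∈⇒≤sum {xs = y ∷ ys} (here refl) = m≤m+n (f y) _
  ∈⇒≤sum {xs = y ∷ ys} (there x∈ys) = ≤-trans (∈⇒≤sum x∈ys) (m≤n+m _ (f y))

  distinct-∈⇒+≤sum : ∀ {x y xs} → x ∈ xs → y ∈ xs → x ≢ y → f x + f y ≤ sum (map f xs)
  distinct-∈⇒+≤sum (here refl) (here refl) x≢y = contradiction refl x≢y
  distinct-∈⇒+≤sum {x} (here refl) (there y∈) _ = +-monoʳ-≤ (f x) (∈⇒≤sum y∈)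
  distinct-∈⇒+≤sum {x} {y} {xs = _ ∷ ys} (there x∈) (here refl) _ =
    subst (_≤ f y + sum (map f ys)) (+-comm (f y) (f x)) (+-monoʳ-≤ (f y) (∈⇒≤sum x∈))
  distinct-∈⇒+≤sum {xs = z ∷ _} (there x∈) (there y∈) x≢y =
    ≤-trans (distinct-∈⇒+≤sum x∈ y∈ x≢y) (m≤n+m _ (f z))

  sum>0⇒∃ : ∀ xs → 0 < sum (map f xs) → ∃[ x ] x ∈ xs × 0 < f x
  sum>0⇒∃ (x ∷ xs) h with f x in fx
  ... | zero  = let (y , y∈ , fy>0) = sum>0⇒∃ xs h in y , there y∈ , fy>0
  ... | suc _ = x , here refl , subst (0 <_) (sym fx) z<s

  sum≥2⇒∃ : ∀ xs → Unique xs → 2 ≤ sum (map f xs) →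
    (∃[ x ] 2 ≤ f x) ⊎ (∃₂ λ x y → x ≢ y × 0 < f x × 0 < f y)
  sum≥2⇒∃ (x ∷ xs) (x∉xs ∷ u) h with f x in fx
  ... | zero = sum≥2⇒∃ xs u h
  sum≥2⇒∃ (x ∷ xs) (x∉xs ∷ u) h | suc zero =
    let (y , y∈ , fy>0) = sum>0⇒∃ xs (≤-pred h)
    in inj₂ (x , y , All.lookup x∉xs y∈ , subst (0 <_) (sym fx) z<s , fy>0)
  sum≥2⇒∃ (x ∷ xs) _ h | suc (suc _) = inj₁ (x , subst (2 ≤_) (sym fx) (s≤s z<s))

  all-zero⇒sum≡0 : ∀ xs → (∀ {x} → x ∈ xs → f x ≡ 0) → sum (map f xs) ≡ 0
  all-zero⇒sum≡0 []       _ = refl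
  all-zero⇒sum≡0 (x ∷ xs) z = cong₂ _+_ (z (here refl)) (all-zero⇒sum≡0 xs (z ∘ there))

module _ (f : ℕ → ℕ) where

  sum-upTo-suc : ∀ m → sum (map f (upTo (suc m))) ≡ sum (map f (upTo m)) + f m
  sum-upTo-suc m = begin
    sum (map f (upTo (suc m)))            ≡⟨ cong (sum ∘ map f) (upTo-∷ʳ m) ⟨
    sum (map f (upTo m ++ m ∷ []))        ≡⟨ cong sum (map-++ f (upTo m) (m ∷ [])) ⟩
    sum (map f (upTo m) ++ f m ∷ [])      ≡⟨ sum-++ (map f (upTo m)) (f m ∷ []) ⟩
    sum (map f (upTo m)) + (f m + 0)      ≡⟨ cong (sum (map f (upTo m)) +_) (+-identityʳ (f m)) ⟩
    sum (map f (upTo m)) + f m            ∎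
    where open ≡-Reasoning

  sum-upTo≡0⇔ : ∀ m → sum (map f (upTo m)) ≡ 0 ⇔ (∀ t → t < m → f t ≡ 0)
  sum-upTo≡0⇔ m = mk⇔
    (λ s≡0 t t<m → n≤0⇒n≡0 (subst (f t ≤_) s≡0 (∈⇒≤sum f (∈-upTo⁺ t<m))))
    (λ z → all-zero⇒sum≡0 f (upTo m) (λ t∈ → z _ (∈-upTo⁻ t∈)))

  -- Once f is positive it stays positive, so the sum can only be 1 if the
  -- single positive term is the last one.
  sum-upTo-suc≡1⇔ : (∀ {s t} → s ≤ t → 0 < f s → 0 < f t) → ∀ m →
    sum (map f (upTo (suc m))) ≡ 1 ⇔ (sum (map f (upTo m)) ≡ 0 × f m ≡ 1)
  sum-upTo-suc≡1⇔ mono m = mk⇔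
    (λ s≡1 → split (sum (map f (upTo m))) (f m) (trans (sym (sum-upTo-suc m)) s≡1) last>0)
    (λ (s≡0 , fm≡1) → trans (sum-upTo-suc m) (cong₂ _+_ s≡0 fm≡1))
    where
    last>0 : 0 < sum (map f (upTo m)) → 0 < f m
    last>0 s>0 = let (t , t∈ , ft>0) = sum>0⇒∃ f (upTo m) s>0 in mono (<⇒≤ (∈-upTo⁻ t∈)) ft>0

    split : ∀ a b → a + b ≡ 1 → (0 < a → 0 < b) → a ≡ 0 × b ≡ 1
    split zero          b       a+b≡1 _   = refl , a+b≡1
    split (suc zero)    zero    _     a⇒b with a⇒b z<s
    ... | ()
    split (suc (suc _)) _       ()    _

m*n>0⇒ : ∀ m n → 0 < m * n → 0 < m × 0 < n
m*n>0⇒ (suc m) zero    h rewrite *-zeroʳ m = contradiction h (<-irrefl refl)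
m*n>0⇒ (suc m) (suc n) _ = z<s , z<s

m*n≥2∧n≤1⇒ : ∀ m n → 2 ≤ m * n → n ≤ 1 → 2 ≤ m × 0 < n
m*n≥2∧n≤1⇒ m zero          h _ rewrite *-zeroʳ m = contradiction h λ ()
m*n≥2∧n≤1⇒ m (suc zero)    h _ rewrite *-identityʳ m = h , z<s
m*n≥2∧n≤1⇒ m (suc (suc n)) _ (s≤s ())

length-∷ʳ : ∀ {A : Set} (xs : List A) x → length (xs ∷ʳ x) ≡ suc (length xs)
length-∷ʳ xs x = trans (length-++ xs) (+-comm (length xs) 1)

≡⊎<⇒≤ : ∀ {A : Set} {xs ys : List A} → xs ≡ ys ⊎ length xs < length ys → length xs ≤ length ys
≡⊎<⇒≤ (inj₁ refl) = ≤-refl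
≡⊎<⇒≤ (inj₂ xs<ys) = <⇒≤ xs<ys

length-∷ʳ⁻ : ∀ {A : Set} (xs : List A) {x t} → length (xs ∷ʳ x) ≡ suc t → length xs ≡ t
length-∷ʳ⁻ xs {x} len = suc-injective (trans (sym (length-∷ʳ xs x)) len)

length-∷ʳ⁺ : ∀ {A : Set} (xs : List A) {x t} → length xs ≡ t → length (xs ∷ʳ x) ≡ suc t
length-∷ʳ⁺ xs {x} len = trans (length-∷ʳ xs x) (cong suc len)

Unique-∷ʳ⁻ : ∀ {A : Set} {xs : List A} {x} → Unique (xs ∷ʳ x) → Unique xs
Unique-∷ʳ⁻ {xs = []}     _             = []
Unique-∷ʳ⁻ {xs = y ∷ ys} (y∉ ∷ unique) = ++⁻ˡ ys y∉ ∷ Unique-∷ʳ⁻ unique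

Unique-∷ʳ⁺ : ∀ {A : Set} {xs : List A} {x} → Unique xs → x ∉ xs → Unique (xs ∷ʳ x)
Unique-∷ʳ⁺ {xs = xs} unique x∉xs = ++⁺ unique ([] ∷ []) λ { (x∈xs , here refl) → x∉xs x∈xs }

-- The walks of Defs.Walk, but grown at the end like lazyWalks; ps still lists
-- the vertices from i to j.
data SnocWalk {n} (G : SimpleGraph n) : Fin n → Fin n → List (Fin n) → Set where
  single : ∀ i → SnocWalk G i i (i ∷ [])
  snoc   : ∀ {i k j ps} → SnocWalk G i k ps → Adj G k j → SnocWalk G i j (ps ∷ʳ j)

module _ {n : ℕ} (G : SimpleGraph n) where

  walk-∷ʳ : ∀ {i k j ps} → Walk G i k ps → Adj G k j → Walk G i j (ps ∷ʳ j)
  walk-∷ʳ (single i) a = cons a (single _)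
  walk-∷ʳ (cons b w) a = cons b (walk-∷ʳ w a)

  snocWalk-∷ : ∀ {i k j ps} → Adj G i k → SnocWalk G k j ps → SnocWalk G i j (i ∷ ps)
  snocWalk-∷ a (single k) = snoc (single _) a
  snocWalk-∷ a (snoc w b) = snoc (snocWalk-∷ a w) b

  snocWalk⇒walk : ∀ {i j ps} → SnocWalk G i j ps → Walk G i j ps
  snocWalk⇒walk (single i) = single i
  snocWalk⇒walk (snoc w a) = walk-∷ʳ (snocWalk⇒walk w) a

  walk⇒snocWalk : ∀ {i j ps} → Walk G i j ps → SnocWalk G i j ps
  walk⇒snocWalk (single i) = single i
  walk⇒snocWalk (cons a w) = snocWalk-∷ a (walk⇒snocWalk w)

  snocWalk-length≢0 : ∀ {i j ps} → SnocWalk G i j ps → length ps ≢ 0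
  snocWalk-length≢0 (single i) ()
  snocWalk-length≢0 (snoc {j = j} {ps} w a) eq with () ← trans (sym (length-∷ʳ ps j)) eq

  snocWalk-ends-with : ∀ {i j ps} → SnocWalk G i j ps → ∃[ qs ] ps ≡ qs ∷ʳ j
  snocWalk-ends-with (single i)              = [] , refl
  snocWalk-ends-with (snoc {ps = ps} w a)    = ps , refl

  lazyStep-refl : ∀ j → lazyStep G j j ≡ 1
  lazyStep-refl j with j ≟ j
  ... | yes _   = refl
  ... | no j≢j  = contradiction refl j≢j

  Adj⇒lazyStep>0 : ∀ {k j} → Adj G k j → 0 < lazyStep G k j
  Adj⇒lazyStep>0 {k} {j} a with k ≟ j
  ... | yes _ = ≤-refl
  ... | no _ with adj G k j | a
  ...   | true  | _  = ≤-refl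
  ...   | false | ()

  lazyStep≤1 : ∀ k j → lazyStep G k j ≤ 1
  lazyStep≤1 k j with k ≟ j
  ... | yes _ = ≤-refl
  ... | no _ with adj G k j
  ...   | true  = ≤-refl
  ...   | false = z≤n

  lazyStep>0⇒ : ∀ k j → 0 < lazyStep G k j → k ≡ j ⊎ Adj G k j
  lazyStep>0⇒ k j h with k ≟ j
  ... | yes k≡j = inj₁ k≡j
  ... | no _ with adj G k j
  ...   | true  = inj₂ _
  ...   | false = contradiction h (<-irrefl refl)

  lazyWalks-zero-refl : ∀ i → lazyWalks G 0 i i ≡ 1
  lazyWalks-zero-refl i with i ≟ i
  ... | yes _  = refl
  ... | no i≢i = contradiction refl i≢i

  lazyWalks-zero>0⇒≡ : ∀ i j → 0 < lazyWalks G 0 i j → i ≡ j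
  lazyWalks-zero>0⇒≡ i j h with i ≟ j
  ... | yes i≡j = i≡j
  ... | no _    = contradiction h (<-irrefl refl)

  viaLast : ℕ → Fin n → Fin n → Fin n → ℕ
  viaLast t i j k = lazyWalks G t i k * lazyStep G k j

  lazyWalks-suc-mono : ∀ {i j} t → 0 < lazyWalks G t i j → 0 < lazyWalks G (suc t) i j
  lazyWalks-suc-mono {i} {j} t h = ≤-trans stay (∈⇒≤sum (viaLast t i j) (∈-allFin j))
    where
    stay : 0 < viaLast t i j j
    stay rewrite lazyStep-refl j | *-identityʳ (lazyWalks G t i j) = h

  lazyWalks-mono : ∀ {i j s t} → s ≤ t → 0 < lazyWalks G s i j → 0 < lazyWalks G t i j
  lazyWalks-mono s≤t = go (≤⇒≤′ s≤t)
    where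
    go : ∀ {i j s t} → s ≤′ t → 0 < lazyWalks G s i j → 0 < lazyWalks G t i j
    go (≤′-reflexive refl)          h = h
    go {t = suc t} (≤′-step s≤′t) h = lazyWalks-suc-mono t (go s≤′t h)

  snocWalk⇒lazyWalks>0 : ∀ {i j ps} t → SnocWalk G i j ps → length ps ≡ suc t → 0 < lazyWalks G t i j
  snocWalk⇒lazyWalks>0 zero    (single i) _ = ≤-reflexive (sym (lazyWalks-zero-refl i))
  snocWalk⇒lazyWalks>0 (suc t) (single i) ()
  snocWalk⇒lazyWalks>0 zero    (snoc {ps = ps} w a) len =
    contradiction (length-∷ʳ⁻ ps len) (snocWalk-length≢0 w)
  snocWalk⇒lazyWalks>0 {i} {j} (suc t) (snoc {k = k} {ps = ps} w a) len =
    ≤-trans (*-mono-≤ (snocWalk⇒lazyWalks>0 t w (length-∷ʳ⁻ ps len))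
                      (Adj⇒lazyStep>0 a))
            (∈⇒≤sum (viaLast t i j) (∈-allFin k))

  lazyWalks>0⇒snocWalk : ∀ {i j} t → 0 < lazyWalks G t i j → ∃[ ps ] SnocWalk G i j ps × length ps ≤ suc t
  lazyWalks>0⇒snocWalk {i} {j} zero h with lazyWalks-zero>0⇒≡ i j h
  ... | refl = i ∷ [] , single i , ≤-refl
  lazyWalks>0⇒snocWalk {i} {j} (suc t) h with sum>0⇒∃ (viaLast t i j) (allFin n) h
  ... | k , _ , via>0 with m*n>0⇒ (lazyWalks G t i k) (lazyStep G k j) via>0
  ...   | walks>0 , step>0 with lazyStep>0⇒ k j step>0 | lazyWalks>0⇒snocWalk t walks>0
  ...     | inj₁ refl | ps , w , len = ps , w , m≤n⇒m≤1+n len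
  ...     | inj₂ a    | ps , w , len = ps ∷ʳ j , snoc w a , ≤-trans (≤-reflexive (length-∷ʳ ps j)) (s≤s len)

  -- lengths count vertices: NoWalkWithin i j m says d(i,j) ≥ m
  NoWalkWithin : Fin n → Fin n → ℕ → Set
  NoWalkWithin i j m = ∀ {ps} → SnocWalk G i j ps → m < length ps

  NoWalkWithin-neighbour : ∀ {i k j m} → NoWalkWithin i j (suc m) → Adj G k j → NoWalkWithin i k m
  NoWalkWithin-neighbour {j = j} {m} none a {ps} w = ≤-pred (subst (suc m <_) (length-∷ʳ ps j) (none (snoc w a)))

  NoWalkWithin⇔lazyWalks≡0 : ∀ i j m → NoWalkWithin i j m ⇔ (∀ t → t < m → lazyWalks G t i j ≡ 0)
  NoWalkWithin⇔lazyWalks≡0 i j m = mk⇔ noWalk⇒zeros zeros⇒noWalk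
    where
    noWalk⇒zeros : NoWalkWithin i j m → ∀ t → t < m → lazyWalks G t i j ≡ 0
    noWalk⇒zeros none t t<m with lazyWalks G t i j in walks
    ... | zero  = refl
    ... | suc _ with lazyWalks>0⇒snocWalk t (subst (0 <_) (sym walks) z<s)
    ...   | ps , w , len = contradiction (≤-trans (none w) len) (<⇒≱ t<m ∘ ≤-pred)

    zeros⇒noWalk : (∀ t → t < m → lazyWalks G t i j ≡ 0) → NoWalkWithin i j m
    zeros⇒noWalk zeros {ps} w with length ps in len
    ... | zero  = contradiction len (snocWalk-length≢0 w)
    ... | suc t with suc t ≤? m
    ...   | no  len≰m = ≰⇒> len≰m
    ...   | yes len≤m = contradiction (zeros t len≤m) (n>0⇒n≢0 (snocWalk⇒lazyWalks>0 t w len))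

  snocWalk-length≡1 : ∀ {i j ps} → SnocWalk G i j ps → length ps ≡ 1 → ps ≡ i ∷ []
  snocWalk-length≡1 (single i)           _   = refl
  snocWalk-length≡1 (snoc {ps = ps} w a) len = contradiction (length-∷ʳ⁻ ps len) (snocWalk-length≢0 w)

  NoWalkWithin⇒lazyWalks>0⇒snocWalk : ∀ {i j} t → NoWalkWithin i j t → 0 < lazyWalks G t i j →
    ∃[ ps ] SnocWalk G i j ps × length ps ≡ suc t
  NoWalkWithin⇒lazyWalks>0⇒snocWalk t none walks>0 =
    let (ps , w , len) = lazyWalks>0⇒snocWalk t walks>0 in ps , w , ≤-antisym len (none w)

  NoWalkWithin⇒lazyStep>0⇒Adj : ∀ {i k j} t → NoWalkWithin i j (suc t) →
    0 < lazyWalks G t i k → 0 < lazyStep G k j → Adj G k j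
  NoWalkWithin⇒lazyStep>0⇒Adj {k = k} {j} t none walks>0 step>0 with lazyStep>0⇒ k j step>0
  ... | inj₂ a    = a
  ... | inj₁ refl =
    let (ps , w , len) = lazyWalks>0⇒snocWalk t walks>0 in contradiction (≤-trans (none w) len) (<-irrefl refl)

  DistinctWalks : Fin n → Fin n → ℕ → Set
  DistinctWalks i j t = ∃₂ λ ps qs → SnocWalk G i j ps × SnocWalk G i j qs ×
                                     length ps ≡ suc t × length qs ≡ suc t × ps ≢ qs

  DistinctWalks⇒lazyWalks≥2 : ∀ {i j} t → DistinctWalks i j t → 2 ≤ lazyWalks G t i j
  DistinctWalks⇒lazyWalks≥2 zero (_ , _ , w , w' , len , len' , ps≢qs) =
    contradiction (trans (snocWalk-length≡1 w len) (sym (snocWalk-length≡1 w' len'))) ps≢qs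
  DistinctWalks⇒lazyWalks≥2 (suc t) (_ , _ , single i , _ , () , _)
  DistinctWalks⇒lazyWalks≥2 (suc t) (_ , _ , _ , single i , _ , () , _)
  DistinctWalks⇒lazyWalks≥2 {i} {j} (suc t)
    (_ , _ , snoc {k = k} {ps = ps} w a , snoc {k = k'} {ps = qs} w' a' , len , len' , ps≢qs) with k ≟ k'
  ... | yes refl =
    ≤-trans (*-mono-≤ (DistinctWalks⇒lazyWalks≥2 t
                         (ps , qs , w , w' , length-∷ʳ⁻ ps len , length-∷ʳ⁻ qs len' , ps≢qs ∘ cong (_∷ʳ j)))
                      (Adj⇒lazyStep>0 a))
            (∈⇒≤sum (viaLast t i j) (∈-allFin k))
  ... | no k≢k' =
    ≤-trans (+-mono-≤ (*-mono-≤ (snocWalk⇒lazyWalks>0 t w (length-∷ʳ⁻ ps len)) (Adj⇒lazyStep>0 a))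
                      (*-mono-≤ (snocWalk⇒lazyWalks>0 t w' (length-∷ʳ⁻ qs len')) (Adj⇒lazyStep>0 a')))
            (distinct-∈⇒+≤sum (viaLast t i j) (∈-allFin k) (∈-allFin k') k≢k')

  -- Either one penultimate vertex k carries two walks (recurse), or two different
  -- ones carry one each; as no walk is shorter, the last step is never lazy.
  NoWalkWithin⇒lazyWalks≥2⇒DistinctWalks : ∀ {i j} t → NoWalkWithin i j t → 2 ≤ lazyWalks G t i j →
    DistinctWalks i j t
  NoWalkWithin⇒lazyWalks≥2⇒DistinctWalks {i} {j} zero _ h with lazyWalks-zero>0⇒≡ i j (<-trans z<s h)
  ... | refl = contradiction (subst (2 ≤_) (lazyWalks-zero-refl i) h) (<-irrefl refl)
  NoWalkWithin⇒lazyWalks≥2⇒DistinctWalks {i} {j} (suc t) none h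
    with sum≥2⇒∃ (viaLast t i j) (allFin n) (allFin⁺ n) h
  ... | inj₁ (k , via≥2) =
    let (walks≥2 , step>0) = m*n≥2∧n≤1⇒ (lazyWalks G t i k) (lazyStep G k j) via≥2 (lazyStep≤1 k j)
        a = NoWalkWithin⇒lazyStep>0⇒Adj t none (<-trans z<s walks≥2) step>0
        (ps , qs , w , w' , len , len' , ps≢qs) =
          NoWalkWithin⇒lazyWalks≥2⇒DistinctWalks t (NoWalkWithin-neighbour none a) walks≥2
    in ps ∷ʳ j , qs ∷ʳ j , snoc w a , snoc w' a , length-∷ʳ⁺ ps len , length-∷ʳ⁺ qs len' ,
       ps≢qs ∘ proj₁ ∘ ∷ʳ-injective ps qs
  ... | inj₂ (k , k' , k≢k' , via>0 , via'>0) =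
    let (ps , w , a , len) = lastStep k via>0
        (qs , w' , a' , len') = lastStep k' via'>0
    in ps ∷ʳ j , qs ∷ʳ j , snoc w a , snoc w' a' , length-∷ʳ⁺ ps len , length-∷ʳ⁺ qs len' ,
       different-penultimate w w'
    where
    lastStep : ∀ k → 0 < viaLast t i j k → ∃[ ps ] SnocWalk G i k ps × Adj G k j × length ps ≡ suc t
    lastStep k via>0 =
      let (walks>0 , step>0) = m*n>0⇒ (lazyWalks G t i k) (lazyStep G k j) via>0
          a = NoWalkWithin⇒lazyStep>0⇒Adj t none walks>0 step>0
          (ps , w , len) = NoWalkWithin⇒lazyWalks>0⇒snocWalk t (NoWalkWithin-neighbour none a) walks>0
      in ps , w , a , len

    different-penultimate : ∀ {ps qs} → SnocWalk G i k ps → SnocWalk G i k' qs → ps ∷ʳ j ≢ qs ∷ʳ j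
    different-penultimate w w' eq with snocWalk-ends-with w | snocWalk-ends-with w'
    ... | ps , refl | qs , refl =
      k≢k' (proj₂ (∷ʳ-injective ps qs (proj₁ (∷ʳ-injective (ps ∷ʳ k) (qs ∷ʳ k') eq))))

  snocWalk-prefix : ∀ {i k x ps} → SnocWalk G i k ps → x ∈ ps →
    ∃[ qs ] SnocWalk G i x qs × length qs ≤ length ps × (Unique ps → Unique qs)
  snocWalk-prefix (single i) (here refl) = i ∷ [] , single i , ≤-refl , λ u → u
  snocWalk-prefix (snoc {j = j} {ps} w a) x∈ with ∈-++⁻ ps x∈
  ... | inj₁ x∈ps =
    let (qs , w' , len , unique) = snocWalk-prefix w x∈ps
    in qs , w' , ≤-trans len (≤-trans (n≤1+n _) (≤-reflexive (sym (length-∷ʳ ps j)))) , unique ∘ Unique-∷ʳ⁻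
  ... | inj₂ (here refl) = ps ∷ʳ j , snoc w a , ≤-refl , λ u → u

  -- cut out the closed subwalk between the two visits of a repeated vertex
  snocWalk⇒path : ∀ {i j ps} → SnocWalk G i j ps → ∃[ qs ] IsPath G i j qs × (qs ≡ ps ⊎ length qs < length ps)
  snocWalk⇒path (single i) = i ∷ [] , (single i , [] ∷ []) , inj₁ refl
  snocWalk⇒path (snoc {j = j} {ps} w a) with snocWalk⇒path w
  ... | qs , (wq , uq) , shorter with any? (j ≟_) qs
  ...   | yes j∈qs =
    let (s , ws , len , us) = snocWalk-prefix (walk⇒snocWalk wq) j∈qs
    in s , (snocWalk⇒walk ws , us uq) ,
       inj₂ (subst (length s <_) (sym (length-∷ʳ ps j)) (s≤s (≤-trans len (≡⊎<⇒≤ shorter))))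
  ...   | no j∉qs = qs ∷ʳ j , (walk-∷ʳ wq a , Unique-∷ʳ⁺ uq j∉qs) , extend shorter
    where
    extend : qs ≡ ps ⊎ length qs < length ps → qs ∷ʳ j ≡ ps ∷ʳ j ⊎ length (qs ∷ʳ j) < length (ps ∷ʳ j)
    extend (inj₁ refl)   = inj₁ refl
    extend (inj₂ qs<ps) = inj₂ (subst₂ _<_ (sym (length-∷ʳ qs j)) (sym (length-∷ʳ ps j)) (s≤s qs<ps))

  shortestPath-≤-snocWalk : ∀ {i j ps qs} → IsShortestPath G i j ps → SnocWalk G i j qs → length ps ≤ length qs
  shortestPath-≤-snocWalk (_ , shortest) w =
    let (s , path , shorter) = snocWalk⇒path w in ≤-trans (shortest s path) (≡⊎<⇒≤ shorter)

  shortestPath-length-unique : ∀ {i j ps qs} → IsShortestPath G i j ps → IsShortestPath G i j qs →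
    length ps ≡ length qs
  shortestPath-length-unique (path , shortest) (path' , shortest') =
    ≤-antisym (shortest _ path') (shortest' _ path)

  shortestPath⇒NoWalkWithin : ∀ {i j ps m} → IsShortestPath G i j ps → length ps ≡ suc m → NoWalkWithin i j m
  shortestPath⇒NoWalkWithin sp len w = subst (_≤ _) len (shortestPath-≤-snocWalk sp w)

  NoWalkWithin⇒shortestPath : ∀ {i j ps m} → NoWalkWithin i j m → SnocWalk G i j ps → length ps ≡ suc m →
    IsShortestPath G i j ps
  NoWalkWithin⇒shortestPath none w len with snocWalk⇒path w
  ... | _ , path , inj₁ refl = path , λ qs pq → subst (_≤ length qs) (sym len) (none (walk⇒snocWalk (proj₁ pq)))
  ... | s , path , inj₂ s<ps =
    contradiction (≤-pred (subst (length s <_) len s<ps)) (<⇒≱ (none (walk⇒snocWalk (proj₁ path))))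

  uniqueShortestPath-init : ∀ {i k j ps} → SnocWalk G i k ps → Adj G k j →
    IsUniqueShortestPath G i j (ps ∷ʳ j) → IsUniqueShortestPath G i k ps
  uniqueShortestPath-init {i} {k} {j} {ps} w a (sp@((_ , unique-ps) , _) , unique) = sp' , unique'
    where
    shortest : ∀ qs → IsPath G i k qs → length ps ≤ length qs
    shortest qs (wq , _) = ≤-pred (subst₂ _≤_ (length-∷ʳ ps j) (length-∷ʳ qs j)
      (shortestPath-≤-snocWalk sp (snoc (walk⇒snocWalk wq) a)))

    sp' : IsShortestPath G i k ps
    sp' = (snocWalk⇒walk w , Unique-∷ʳ⁻ unique-ps) , shortest

    unique' : ∀ qs → IsShortestPath G i k qs → qs ≡ ps
    unique' qs sq@((wq , _) , _) = proj₁ (∷ʳ-injective qs ps (unique (qs ∷ʳ j)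
      (NoWalkWithin⇒shortestPath (shortestPath⇒NoWalkWithin sp (length-∷ʳ ps j))
        (snoc (walk⇒snocWalk wq) a)
        (length-∷ʳ⁺ qs (shortestPath-length-unique sq sp')))))

  uniqueShortestPath-prefix : ∀ {i j ps} m → SnocWalk G i j ps → IsUniqueShortestPath G i j ps →
    suc m ≤ length ps → ∃₂ λ j' ps' → IsUniqueShortestPath G i j' ps' × length ps' ≡ suc m
  uniqueShortestPath-prefix zero    (single i) usp _ = i , i ∷ [] , usp , refl
  uniqueShortestPath-prefix (suc m) (single i) _ (s≤s ())
  uniqueShortestPath-prefix m (snoc {j = j} {ps} w a) usp m<len with suc m ≤? length ps
  ... | yes m<ps = uniqueShortestPath-prefix m w (uniqueShortestPath-init w a usp) m<ps
  ... | no  m≮ps = _ , _ , usp , ≤-antisym (subst (_≤ suc m) (sym (length-∷ʳ ps j)) (≰⇒> m≮ps)) m<len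

  lazyWalks≡1⇔uniqueShortestPath : ∀ {i j} r → NoWalkWithin i j r →
    lazyWalks G r i j ≡ 1 ⇔ (∃[ ps ] IsUniqueShortestPath G i j ps × length ps ≡ suc r)
  lazyWalks≡1⇔uniqueShortestPath {i} {j} r none = mk⇔ one⇒usp usp⇒one
    where
    exact⇒shortest : ∀ {ps} → SnocWalk G i j ps → length ps ≡ suc r → IsShortestPath G i j ps
    exact⇒shortest = NoWalkWithin⇒shortestPath none

    one⇒usp : lazyWalks G r i j ≡ 1 → ∃[ ps ] IsUniqueShortestPath G i j ps × length ps ≡ suc r
    one⇒usp one with NoWalkWithin⇒lazyWalks>0⇒snocWalk r none (≤-reflexive (sym one))
    ... | ps , w , len = ps , (sp , unique) , len
      where
      sp : IsShortestPath G i j ps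
      sp = exact⇒shortest w len

      unique : ∀ qs → IsShortestPath G i j qs → qs ≡ ps
      unique qs sq with ≡-dec _≟_ qs ps
      ... | yes qs≡ps = qs≡ps
      ... | no  qs≢ps = contradiction
        (DistinctWalks⇒lazyWalks≥2 r (qs , ps , walk⇒snocWalk (proj₁ (proj₁ sq)) , w ,
          trans (shortestPath-length-unique sq sp) len , len , qs≢ps))
        (λ two → <-irrefl refl (subst (2 ≤_) one two))

    usp⇒one : ∃[ ps ] IsUniqueShortestPath G i j ps × length ps ≡ suc r → lazyWalks G r i j ≡ 1
    usp⇒one (ps , (sp , unique) , len) = ≤-antisym (≤-pred (≰⇒> not-two)) one-walk
      where
      one-walk : 0 < lazyWalks G r i j
      one-walk = snocWalk⇒lazyWalks>0 r (walk⇒snocWalk (proj₁ (proj₁ sp))) len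

      not-two : ¬ 2 ≤ lazyWalks G r i j
      not-two two with NoWalkWithin⇒lazyWalks≥2⇒DistinctWalks r none two
      ... | qs , qs' , w , w' , len , len' , qs≢qs' =
        qs≢qs' (trans (unique qs (exact⇒shortest w len)) (sym (unique qs' (exact⇒shortest w' len'))))

  gammaMult≡1⇔uniqueShortestPath : ∀ r i j →
    gammaMult G r i j ≡ 1 ⇔ (∃[ ps ] IsUniqueShortestPath G i j ps × length ps ≡ suc r)
  gammaMult≡1⇔uniqueShortestPath r i j = mk⇔
    (λ γ≡1 →
      let (earlier≡0 , last≡1) = to (sum-upTo-suc≡1⇔ f mono r) γ≡1
      in to (lazyWalks≡1⇔uniqueShortestPath r (noWalk earlier≡0)) last≡1)
    (λ usp@(_ , (sp , _) , len) →
      let none = shortestPath⇒NoWalkWithin sp len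
      in from (sum-upTo-suc≡1⇔ f mono r)
           ( from (sum-upTo≡0⇔ f r) (to (NoWalkWithin⇔lazyWalks≡0 i j r) none)
           , from (lazyWalks≡1⇔uniqueShortestPath r none) usp))
    where
    f : ℕ → ℕ
    f t = lazyWalks G t i j

    mono : ∀ {s t} → s ≤ t → 0 < f s → 0 < f t
    mono {s} {t} = lazyWalks-mono {i} {j} {s} {t}

    noWalk : sum (map f (upTo r)) ≡ 0 → NoWalkWithin i j r
    noWalk = from (NoWalkWithin⇔lazyWalks≡0 i j r) ∘ to (sum-upTo≡0⇔ f r)

  noGammaMultOne⇔uniqueShortestPaths≤ : ∀ r → 0 < r →
    (∀ i j → i ≢ j → gammaMult G r i j ≢ 1) ⇔
    (∀ i j ps → IsUniqueShortestPath G i j ps → length ps ≤ r)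
  noGammaMultOne⇔uniqueShortestPaths≤ r r>0 = mk⇔ bounded unbounded
    where
    bounded : (∀ i j → i ≢ j → gammaMult G r i j ≢ 1) → ∀ i j ps → IsUniqueShortestPath G i j ps → length ps ≤ r
    bounded noOne i j ps usp with length ps ≤? r
    ... | yes ps≤r = ps≤r
    ... | no  ps≰r with uniqueShortestPath-prefix r (walk⇒snocWalk (proj₁ (proj₁ (proj₁ usp)))) usp (≰⇒> ps≰r)
    ...   | j' , ps' , usp' , len = contradiction (from (gammaMult≡1⇔uniqueShortestPath r i j') (ps' , usp' , len))
                                                  (noOne i j' i≢j')
      where
      -- the trivial path shows d(i,i) = 0, while d(i,j') = r > 0
      i≢j' : i ≢ j'
      i≢j' refl = contradiction (subst (_≤ 1) len (proj₂ (proj₁ usp') (i ∷ []) (single i , [] ∷ [])))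
                                (<⇒≱ (s≤s r>0))

    unbounded : (∀ i j ps → IsUniqueShortestPath G i j ps → length ps ≤ r) → ∀ i j → i ≢ j → gammaMult G r i j ≢ 1
    unbounded bound i j _ γ≡1 =
      let (ps , usp , len) = to (gammaMult≡1⇔uniqueShortestPath r i j) γ≡1
      in <-irrefl refl (subst (_≤ r) len (bound i j ps usp))

∣∁⁅v⁆∣<n : ∀ {n} (v : Fin n) → ∣ ∁ ⁅ v ⁆ ∣ < n
∣∁⁅v⁆∣<n {suc m} v = ≤-reflexive (cong suc (trans (∣∁p∣≡n∸∣p∣ ⁅ v ⁆) (cong (suc m ∸_) (∣⁅x⁆∣≡1 v))))

module _ {n : ℕ} (H : SimpleGraph n) where

  ZFReach⇒PSDReach : ∀ {S B} → ZFReach H S B → PSDReach H S B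
  ZFReach⇒PSDReach start = start
  ZFReach⇒PSDReach (force u w R (u∈B , w∉B , a , only)) =
    force u w (ZFReach⇒PSDReach R) (u∈B , w∉B , a , λ x ux x∉B _ → only x ux x∉B)

  Adj⇒∁⁅v⁆-isZFSet : ∀ {u v} → Adj H u v → IsZFSet H (∁ ⁅ v ⁆)
  Adj⇒∁⁅v⁆-isZFSet {u} {v} a = subst (ZFReach H (∁ ⁅ v ⁆)) (∪-inverseˡ ⁅ v ⁆)
    (force u v start (u∈ , x∈p⇒x∉∁p (x∈⁅x⁆ v) , a , λ x _ x∉ → x∈⁅y⁆⇒x≡y v (x∉∁p⇒x∈p x∉)))
    where
    u∈ : u ∈ˢ ∁ ⁅ v ⁆
    u∈ = x∉p⇒x∈∁p (x≢y⇒x∉⁅y⁆ λ { refl → subst T (irrfl H u) a })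

  IsZ⇒≤n : ∀ {m} → IsZ H m → m ≤ n
  IsZ⇒≤n Z = subst (_ ≤_) (∣⊤∣≡n n) (proj₂ Z ⊤ start)

  IsZ₊⇒≤n : ∀ {m} → IsZ₊ H m → m ≤ n
  IsZ₊⇒≤n Z = subst (_ ≤_) (∣⊤∣≡n n) (proj₂ Z ⊤ start)

  IsZ[n]⇒edgeless : IsZ H n → ∀ u v → ¬ Adj H u v
  IsZ[n]⇒edgeless Z u v a = <⇒≱ (∣∁⁅v⁆∣<n v) (proj₂ Z _ (Adj⇒∁⁅v⁆-isZFSet a))

  IsZ₊[n]⇒edgeless : IsZ₊ H n → ∀ u v → ¬ Adj H u v
  IsZ₊[n]⇒edgeless Z u v a = <⇒≱ (∣∁⁅v⁆∣<n v) (proj₂ Z _ (ZFReach⇒PSDReach (Adj⇒∁⁅v⁆-isZFSet a)))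

module _ (n : ℕ) where

  emptyGraph-ZFReach : ∀ {S B} → ZFReach (emptyGraph n) S B → B ≡ S
  emptyGraph-ZFReach start = refl
  emptyGraph-ZFReach (force _ _ _ (_ , _ , () , _))

  emptyGraph-PSDReach : ∀ {S B} → PSDReach (emptyGraph n) S B → B ≡ S
  emptyGraph-PSDReach start = refl
  emptyGraph-PSDReach (force _ _ _ (_ , _ , () , _))

  IsZ-emptyGraph : IsZ (emptyGraph n) n
  IsZ-emptyGraph = (⊤ , start , ∣⊤∣≡n n) , λ S R →
    ≤-reflexive (trans (sym (∣⊤∣≡n n)) (cong ∣_∣ (emptyGraph-ZFReach R)))

  IsZ₊-emptyGraph : IsZ₊ (emptyGraph n) n
  IsZ₊-emptyGraph = (⊤ , start , ∣⊤∣≡n n) , λ S R →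
    ≤-reflexive (trans (sym (∣⊤∣≡n n)) (cong ∣_∣ (emptyGraph-PSDReach R)))

module _ {n : ℕ} (G : SimpleGraph n) (r : ℕ) where

  edgeless-config⇒emptyGraph-config : ∀ {H} → IsEdgeConfig G r H → (∀ u v → ¬ Adj H u v) →
    IsEdgeConfig G r (emptyGraph n)
  edgeless-config⇒emptyGraph-config config edgeless i j i≢j =
    (λ γ≡1 → edgeless i j (proj₁ (config i j i≢j) γ≡1)) , λ _ ()

  IsZr[n]⇔emptyGraph-config : IsZr G r n ⇔ IsEdgeConfig G r (emptyGraph n)
  IsZr[n]⇔emptyGraph-config = mk⇔
    (λ ((H , config , Z) , _) → edgeless-config⇒emptyGraph-config {H} config (IsZ[n]⇒edgeless H Z))
    (λ config → (emptyGraph n , config , IsZ-emptyGraph n) , λ H _ _ Z → IsZ⇒≤n H Z)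

  IsZ₊r[n]⇔emptyGraph-config : IsZ₊r G r n ⇔ IsEdgeConfig G r (emptyGraph n)
  IsZ₊r[n]⇔emptyGraph-config = mk⇔
    (λ ((H , config , Z) , _) → edgeless-config⇒emptyGraph-config {H} config (IsZ₊[n]⇒edgeless H Z))
    (λ config → (emptyGraph n , config , IsZ₊-emptyGraph n) , λ H _ _ Z → IsZ₊⇒≤n H Z)

  emptyGraph-config⇔noGammaMultOne : IsEdgeConfig G r (emptyGraph n) ⇔ (∀ i j → i ≢ j → gammaMult G r i j ≢ 1)
  emptyGraph-config⇔noGammaMultOne = mk⇔
    (λ config i j i≢j → proj₁ (config i j i≢j))
    (λ noOne i j i≢j → noOne i j i≢j , λ _ ())

mainTheorem6 : ∀ (n : ℕ) (G : SimpleGraph n) (r : ℕ) → 0 < r →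
    (IsZr G r n ⇔ IsZ₊r G r n) ×
    (IsZ₊r G r n ⇔ IsEdgeConfig G r (emptyGraph n)) ×
    (IsEdgeConfig G r (emptyGraph n) ⇔
      (∀ (i j : Fin n) (p : List (Fin n)) → IsUniqueShortestPath G i j p → length p ≤ r))
mainTheorem6 n G r r>0 =
  ⇔-trans (IsZr[n]⇔emptyGraph-config G r) (⇔-sym (IsZ₊r[n]⇔emptyGraph-config G r)) ,
  IsZ₊r[n]⇔emptyGraph-config G r ,
  ⇔-trans (emptyGraph-config⇔noGammaMultOne G r) (noGammaMultOne⇔uniqueShortestPaths≤ G r r>0)
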